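{- There is at most one series $U\in\mathbb Z[\sigma_1,\sigma_2,\dots][[x]]$ with constant term $1$ such that, for every $n\ge1$, the coefficient of $x^n$ is of degree at most $2n$ with respect to the grading $\deg\sigma_i=i$ and belongs to the ideal of $\mathbb Z[\sigma_1,\sigma_2,\dots]$ generated by $\sigma_{n+1},\sigma_{n+2},\dots,\sigma_{2n}$, and which satisfies the functional equation $$(1-\sigma_1x)\,U(x,\sigma_1,\sigma_2,\sigma_3,\dots)=U(x,1+\sigma_1,\sigma_1+\sigma_2,\sigma_2+\sigma_3,\dots).$$ -}

module Defs where

open import Data.Nat as ℕ using (ℕ; zero; suc; _≤_)
open import Data.Integer as ℤ using (ℤ; +_)
open import Data.Fin using (Fin; toℕ)
open import Data.List using (List; []; _∷_; _++_; concatMap; map; replicate)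
open import Data.List.Properties using (≡-dec)
open import Data.Product using (_×_; _,_; Σ; ∃)
open import Relation.Binary.PropositionalEquality using (_≡_; _≢_)
open import Relation.Nullary using (yes; no)

-- A monomial σ₁^{e₀} σ₂^{e₁} σ₃^{e₂} ⋯ is its exponent list
-- e₀ ∷ e₁ ∷ e₂ ∷ …  (index i stores the exponent of σ_{i+1});
-- lists differing by trailing zeros denote the same monomial.
-- A polynomial is a finite formal sum of terms (coefficient, monomial);
-- two polynomials are equal (_≈_) iff all their coefficients agree.

Mono : Set
Mono = List ℕ

Poly : Set
Poly = List (ℤ × Mono)

cons0 : ℕ → Mono → Mono
cons0 zero [] = []
cons0 e es = e ∷ es

norm : Mono → Mono
norm [] = []
norm (e ∷ es) = cons0 e (norm es)

monoMul : Mono → Mono → Mono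
monoMul [] m = m
monoMul (e ∷ es) [] = e ∷ es
monoMul (e ∷ es) (f ∷ fs) = (e ℕ.+ f) ∷ monoMul es fs

coeff : Poly → Mono → ℤ
coeff [] m = + 0
coeff ((c , m') ∷ p) m with ≡-dec ℕ._≟_ (norm m') (norm m)
... | yes _ = c ℤ.+ coeff p m
... | no  _ = coeff p m

infix 4 _≈_
_≈_ : Poly → Poly → Set
p ≈ q = ∀ m → coeff p m ≡ coeff q m

const : ℤ → Poly
const c = (c , []) ∷ []

0P 1P : Poly
0P = []
1P = const (+ 1)

infixl 6 _+P_ _-P_
infixl 7 _*P_

_+P_ : Poly → Poly → Poly
p +P q = p ++ q

negP : Poly → Poly
negP = map (λ { (c , m) → (ℤ.- c , m) })

_-P_ : Poly → Poly → Poly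
p -P q = p +P negP q

_*P_ : Poly → Poly → Poly
p *P q = concatMap (λ { (c , m) → map (λ { (d , n) → (c ℤ.* d , monoMul m n) }) q }) p

_^P_ : Poly → ℕ → Poly
p ^P zero = 1P
p ^P suc k = p *P (p ^P k)

-- the variable σ_{j+1} (0-based index j)
var : ℕ → Poly
var j = (+ 1 , replicate j 0 ++ (1 ∷ [])) ∷ []

-- σ k with the convention σ 0 = 1; σ (suc j) = σ_{j+1}
σ : ℕ → Poly
σ zero = 1P
σ (suc j) = var j

evalMono : (ℕ → Poly) → Mono → Poly
evalMono s [] = 1P
evalMono s (e ∷ es) = (s 0 ^P e) *P evalMono (λ j → s (suc j)) es

eval : (ℕ → Poly) → Poly → Poly
eval s [] = 0P
eval s ((c , m) ∷ p) = (const c *P evalMono s m) +P eval s p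

-- the shift σ_k ↦ σ_{k-1} + σ_k  (σ₀ = 1), i.e.
-- (σ₁, σ₂, σ₃, …) ↦ (1 + σ₁, σ₁ + σ₂, σ₂ + σ₃, …)
shift : ℕ → Poly
shift j = σ j +P σ (suc j)

wdeg' : ℕ → Mono → ℕ
wdeg' k [] = 0
wdeg' k (e ∷ es) = k ℕ.* e ℕ.+ wdeg' (suc k) es

wdeg : Mono → ℕ
wdeg = wdeg' 1

DegLe : Poly → ℕ → Set
DegLe p d = ∀ m → coeff p m ≢ + 0 → wdeg m ≤ d

sumFin : (n : ℕ) → (Fin n → Poly) → Poly
sumFin zero f = 0P
sumFin (suc n) f = f Fin.zero +P sumFin n (λ i → f (Fin.suc i))

InIdeal : ℕ → Poly → Set
InIdeal n p = Σ (Fin n → Poly) λ a →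
  p ≈ sumFin n (λ i → σ (suc n ℕ.+ toℕ i) *P a i)

-- Power series in x over ℤ[σ₁, σ₂, …]: U n = coefficient of x^n.

Series : Set
Series = ℕ → Poly

-- (1 - σ₁ x) U(x, σ) = U(x, shift σ), compared coefficientwise in x
FunEq : Series → Set
FunEq U = (U 0 ≈ eval shift (U 0))
        × (∀ n → U (suc n) -P σ 1 *P U n ≈ eval shift (U (suc n)))

Admissible : Series → Set
Admissible U = (U 0 ≈ 1P)
             × (∀ n → DegLe (U (suc n)) (2 ℕ.* suc n))
             × (∀ n → InIdeal (suc n) (U (suc n)))
             × FunEq U

-- If U and V agree below x^(n+1), the difference D of their coefficients of
-- x^(n+1) is invariant under the shift σ_k ↦ σ_(k-1) + σ_k, because the factor
-- 1 - σ₁x only brings in lower coefficients. Moreover, with N = n + 1, D has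
-- degree at most 2N and each of its monomials contains some σ_j with j > N, so
-- each monomial is such a σ_j times variables of degree < N. By induction on
-- j ≥ N no monomial of D contains σ_j: for j = N the degree is too large, and
-- the step compares leading coefficients on both sides of D = shift D.
-- Hence D = 0.

module Submission where

open import Defs
open import Data.Nat
  using (ℕ; zero; suc; _+_; _*_; _∸_; _⊔_; _≤_; _<_; z≤n; s≤s; _≟_; _≤?_; _<?_; ≢-nonZero)
open import Data.Nat.Properties
import Data.Nat.Tactic.RingSolver as ℕ-Solver
open import Data.Integer as ℤ using (ℤ; +_)
import Data.Integer.Properties as ℤₚ
open import Data.Integer.Tactic.RingSolver using (solve-∀)
open import Data.List using (List; []; _∷_; _++_; map; replicate; length)
open import Data.List.Properties using (≡-dec)
open import Data.Product using (_×_; _,_; Σ; proj₁; proj₂)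
open import Data.Sum using (_⊎_; inj₁; inj₂)
open import Data.Empty using (⊥-elim)
open import Data.Fin using (Fin; toℕ)
open import Data.Fin.Properties using (any?)
open import Relation.Binary.PropositionalEquality
open import Relation.Binary.Definitions using (tri<; tri≈; tri>)
open import Relation.Nullary using (¬_; ¬?; yes; no)
open import Relation.Nullary.Decidable using (decidable-stable)

-- Monomials through their exponents

expo : Mono → ℕ → ℕ
expo [] k = 0
expo (e ∷ es) zero = e
expo (e ∷ es) (suc k) = expo es k

expo-cons0 : ∀ e es k → expo (cons0 e es) k ≡ expo (e ∷ es) k
expo-cons0 zero [] zero = refl
expo-cons0 zero [] (suc k) = refl
expo-cons0 zero (x ∷ xs) k = refl
expo-cons0 (suc e) es k = refl

expo-norm : ∀ m k → expo (norm m) k ≡ expo m k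
expo-norm [] k = refl
expo-norm (e ∷ es) zero = expo-cons0 e (norm es) zero
expo-norm (e ∷ es) (suc k) = trans (expo-cons0 e (norm es) (suc k)) (expo-norm es k)

expo≗⇒norm≡ : ∀ a b → (∀ k → expo a k ≡ expo b k) → norm a ≡ norm b
expo≗⇒norm≡ [] [] h = refl
expo≗⇒norm≡ [] (f ∷ fs) h
  rewrite sym (h 0) | sym (expo≗⇒norm≡ [] fs (λ k → h (suc k))) = refl
expo≗⇒norm≡ (e ∷ es) [] h
  rewrite h 0 | expo≗⇒norm≡ es [] (λ k → h (suc k)) = refl
expo≗⇒norm≡ (e ∷ es) (f ∷ fs) h =
  cong₂ cons0 (h 0) (expo≗⇒norm≡ es fs (λ k → h (suc k)))

norm≡⇒expo≗ : ∀ a b → norm a ≡ norm b → ∀ k → expo a k ≡ expo b k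
norm≡⇒expo≗ a b eq k =
  trans (sym (expo-norm a k)) (trans (cong (λ x → expo x k) eq) (expo-norm b k))

expo-monoMul : ∀ a b k → expo (monoMul a b) k ≡ expo a k + expo b k
expo-monoMul [] b k = refl
expo-monoMul (e ∷ es) [] k = sym (+-identityʳ _)
expo-monoMul (e ∷ es) (f ∷ fs) zero = refl
expo-monoMul (e ∷ es) (f ∷ fs) (suc k) = expo-monoMul es fs k

monoMul-normˡ : ∀ u u' v → norm u ≡ norm u' → norm (monoMul u v) ≡ norm (monoMul u' v)
monoMul-normˡ u u' v e = expo≗⇒norm≡ (monoMul u v) (monoMul u' v) λ k →
  trans (expo-monoMul u v k)
    (trans (cong (_+ expo v k) (norm≡⇒expo≗ u u' e k)) (sym (expo-monoMul u' v k)))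

monoMul-normʳ : ∀ u v v' → norm v ≡ norm v' → norm (monoMul u v) ≡ norm (monoMul u v')
monoMul-normʳ u v v' e = expo≗⇒norm≡ (monoMul u v) (monoMul u v') λ k →
  trans (expo-monoMul u v k)
    (trans (cong (_+_ (expo u k)) (norm≡⇒expo≗ v v' e k)) (sym (expo-monoMul u v' k)))

mpow : Mono → ℕ → Mono
mpow u zero = []
mpow u (suc e) = monoMul u (mpow u e)

expo-mpow : ∀ u e k → expo (mpow u e) k ≡ e * expo u k
expo-mpow u zero k = refl
expo-mpow u (suc e) k = trans (expo-monoMul u (mpow u e) k) (cong (_+_ (expo u k)) (expo-mpow u e k))

unitMono : ℕ → Mono
unitMono j = replicate j 0 ++ (1 ∷ [])

δ : ℕ → ℕ → ℕ
δ zero zero = 1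
δ zero (suc k) = 0
δ (suc j) zero = 0
δ (suc j) (suc k) = δ j k

δ-diag : ∀ j → δ j j ≡ 1
δ-diag zero = refl
δ-diag (suc j) = δ-diag j

δ-≢ : ∀ j k → j ≢ k → δ j k ≡ 0
δ-≢ zero zero ne = ⊥-elim (ne refl)
δ-≢ zero (suc k) ne = refl
δ-≢ (suc j) zero ne = refl
δ-≢ (suc j) (suc k) ne = δ-≢ j k (λ e → ne (cong suc e))

expo-unitMono : ∀ j k → expo (unitMono j) k ≡ δ j k
expo-unitMono zero zero = refl
expo-unitMono zero (suc k) = refl
expo-unitMono (suc j) zero = refl
expo-unitMono (suc j) (suc k) = expo-unitMono j k

-- Weights of monomials

weight : Mono → (ℕ → ℕ) → ℕ
weight [] f = 0
weight (e ∷ es) f = e * f 0 + weight es (λ k → f (suc k))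

weight-cong : ∀ w f g → (∀ k → expo w k * f k ≡ expo w k * g k) → weight w f ≡ weight w g
weight-cong [] f g h = refl
weight-cong (e ∷ es) f g h = cong₂ _+_ (h 0) (weight-cong es _ _ (λ k → h (suc k)))

weight-cong-≗ : ∀ w f g → (∀ k → f k ≡ g k) → weight w f ≡ weight w g
weight-cong-≗ w f g h = weight-cong w f g (λ k → cong (expo w k *_) (h k))

weight-cons0 : ∀ e x f → weight (cons0 e x) f ≡ weight (e ∷ x) f
weight-cons0 zero [] f = refl
weight-cons0 zero (y ∷ ys) f = refl
weight-cons0 (suc e) x f = refl

weight-norm : ∀ w f → weight (norm w) f ≡ weight w f
weight-norm [] f = refl
weight-norm (e ∷ es) f =
  trans (weight-cons0 e (norm es) f) (cong (_+_ (e * f 0)) (weight-norm es _))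

norm≡⇒weight≡ : ∀ a b f → norm a ≡ norm b → weight a f ≡ weight b f
norm≡⇒weight≡ a b f eq =
  trans (sym (weight-norm a f)) (trans (cong (λ x → weight x f) eq) (weight-norm b f))

+-interchange : ∀ a b c d → (a + b) + (c + d) ≡ (a + c) + (b + d)
+-interchange = ℕ-Solver.solve-∀

weight-monoMul : ∀ a b f → weight (monoMul a b) f ≡ weight a f + weight b f
weight-monoMul [] b f = refl
weight-monoMul (e ∷ es) [] f = sym (+-identityʳ _)
weight-monoMul (e ∷ es) (g ∷ gs) f
  rewrite weight-monoMul es gs (λ k → f (suc k)) | *-distribʳ-+ (f 0) e g =
  +-interchange (e * f 0) (g * f 0) _ _

weight-+ : ∀ w f g → weight w (λ l → f l + g l) ≡ weight w f + weight w g
weight-+ [] f g = refl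
weight-+ (e ∷ es) f g
  rewrite weight-+ es (λ l → f (suc l)) (λ l → g (suc l)) | *-distribˡ-+ e (f 0) (g 0) =
  +-interchange (e * f 0) (e * g 0) _ _

weight-mpow : ∀ u e f → weight (mpow u e) f ≡ e * weight u f
weight-mpow u zero f = refl
weight-mpow u (suc e) f =
  trans (weight-monoMul u (mpow u e) f) (cong (_+_ (weight u f)) (weight-mpow u e f))

weight-unitMono : ∀ j f → weight (unitMono j) f ≡ f j
weight-unitMono zero f = trans (+-identityʳ _) (*-identityˡ _)
weight-unitMono (suc j) f = weight-unitMono j _

weight-zero : ∀ w f → (∀ k → f k ≡ 0) → weight w f ≡ 0
weight-zero [] f h = refl
weight-zero (x ∷ xs) f h rewrite h 0 | *-zeroʳ x = weight-zero xs _ (λ k → h (suc k))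

weight-δ : ∀ w k → weight w (λ l → δ l k) ≡ expo w k
weight-δ [] k = refl
weight-δ (e ∷ es) zero
  rewrite *-identityʳ e | weight-zero es (λ l → δ (suc l) zero) (λ _ → refl) = +-identityʳ e
weight-δ (e ∷ es) (suc k) rewrite *-zeroʳ e = weight-δ es k

weight-mono-≤ : ∀ w f g → (∀ k → f k ≤ g k) → weight w f ≤ weight w g
weight-mono-≤ [] f g h = z≤n
weight-mono-≤ (e ∷ es) f g h =
  +-mono-≤ (*-monoʳ-≤ e (h 0)) (weight-mono-≤ es _ _ (λ k → h (suc k)))

term≤weight : ∀ w f j → expo w j * f j ≤ weight w f
term≤weight [] f j = z≤n
term≤weight (e ∷ es) f zero = m≤m+n (e * f 0) _
term≤weight (e ∷ es) f (suc j) =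
  ≤-trans (term≤weight es (λ k → f (suc k)) j) (m≤n+m _ (e * f 0))

weight-extract : ∀ w f g j → (∀ k → k ≢ j → f k ≤ g k) → f j ≡ 0 →
                 weight w f + expo w j * g j ≤ weight w g
weight-extract [] f g j h z = z≤n
weight-extract (e ∷ es) f g zero h z rewrite z | *-zeroʳ e =
  ≤-trans (≤-reflexive (+-comm (weight es (λ k → f (suc k))) (e * g 0)))
    (+-monoʳ-≤ (e * g 0) (weight-mono-≤ es _ _ (λ k → h (suc k) (λ ()))))
weight-extract (e ∷ es) f g (suc j) h z =
  ≤-trans (≤-reflexive (+-assoc (e * f 0) (weight es (λ k → f (suc k))) (expo es j * g (suc j))))
    (+-mono-≤ (*-monoʳ-≤ e (h 0 (λ ())))
      (weight-extract es _ _ j (λ k ne → h (suc k) (λ e' → ne (suc-injective e'))) z))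

two-terms≤weight : ∀ w g j k → k ≢ j → expo w j * g j + expo w k * g k ≤ weight w g
two-terms≤weight w g j k k≢j = begin
  expo w j * g j + expo w k * g k         ≤⟨ +-monoʳ-≤ (expo w j * g j) k-term ⟩
  expo w j * g j + weight w g₀            ≡⟨ +-comm (expo w j * g j) _ ⟩
  weight w g₀ + expo w j * g j            ≤⟨ weight-extract w g₀ g j (λ l l≢j → ≤-reflexive (g₀-≢ l l≢j)) g₀-j ⟩
  weight w g                              ∎
  where
  open ≤-Reasoning
  g₀ : ℕ → ℕ
  g₀ l with l ≟ j
  ... | yes _ = 0
  ... | no _ = g l
  g₀-j : g₀ j ≡ 0
  g₀-j with j ≟ j
  ... | yes _ = refl
  ... | no ne = ⊥-elim (ne refl)
  g₀-≢ : ∀ l → l ≢ j → g₀ l ≡ g l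
  g₀-≢ l l≢j with l ≟ j
  ... | yes e = ⊥-elim (l≢j e)
  ... | no _ = refl
  k-term : expo w k * g k ≤ weight w g₀
  k-term = subst (λ x → expo w k * x ≤ weight w g₀) (g₀-≢ k k≢j) (term≤weight w g₀ k)

wdeg'≡weight : ∀ k m → wdeg' k m ≡ weight m (_+_ k)
wdeg'≡weight k [] = refl
wdeg'≡weight k (e ∷ es) =
  cong₂ _+_ (trans (*-comm k e) (cong (e *_) (sym (+-identityʳ k))))
    (trans (wdeg'≡weight (suc k) es) (weight-cong-≗ es _ _ (λ l → sym (+-suc k l))))

-- Coefficients as linear functionals

monoδ : Mono → Mono → ℤ
monoδ u m with ≡-dec _≟_ (norm u) (norm m)
... | yes _ = + 1
... | no _ = + 0

monoδ-≡ : ∀ u m → norm u ≡ norm m → monoδ u m ≡ + 1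
monoδ-≡ u m eq with ≡-dec _≟_ (norm u) (norm m)
... | yes _ = refl
... | no ne = ⊥-elim (ne eq)

monoδ-≢ : ∀ u m → norm u ≢ norm m → monoδ u m ≡ + 0
monoδ-≢ u m ne with ≡-dec _≟_ (norm u) (norm m)
... | yes eq = ⊥-elim (ne eq)
... | no _ = refl

monoδ-normˡ : ∀ u u' m → norm u ≡ norm u' → monoδ u m ≡ monoδ u' m
monoδ-normˡ u u' m eq with ≡-dec _≟_ (norm u) (norm m) | ≡-dec _≟_ (norm u') (norm m)
... | yes _ | yes _ = refl
... | no _ | no _ = refl
... | yes e | no ne = ⊥-elim (ne (trans (sym eq) e))
... | no ne | yes e = ⊥-elim (ne (trans eq e))

coeff-∷ : ∀ c u p m → coeff ((c , u) ∷ p) m ≡ c ℤ.* monoδ u m ℤ.+ coeff p m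
coeff-∷ c u p m with ≡-dec _≟_ (norm u) (norm m)
... | yes _ = cong (ℤ._+ coeff p m) (sym (ℤₚ.*-identityʳ c))
... | no _ = sym (trans (cong (ℤ._+ coeff p m) (ℤₚ.*-zeroʳ c)) (ℤₚ.+-identityˡ _))

linear : (Mono → ℤ) → Poly → ℤ
linear h [] = + 0
linear h ((c , u) ∷ p) = c ℤ.* h u ℤ.+ linear h p

coeff≡linear : ∀ p m → coeff p m ≡ linear (λ u → monoδ u m) p
coeff≡linear [] m = refl
coeff≡linear ((c , u) ∷ p) m =
  trans (coeff-∷ c u p m) (cong (ℤ._+_ (c ℤ.* monoδ u m)) (coeff≡linear p m))

linear-+P : ∀ h p q → linear h (p +P q) ≡ linear h p ℤ.+ linear h q
linear-+P h [] q = sym (ℤₚ.+-identityˡ _)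
linear-+P h ((c , u) ∷ p) q rewrite linear-+P h p q =
  sym (ℤₚ.+-assoc (c ℤ.* h u) (linear h p) (linear h q))

linear-negP : ∀ h p → linear h (negP p) ≡ ℤ.- linear h p
linear-negP h [] = refl
linear-negP h ((c , u) ∷ p) rewrite linear-negP h p =
  sym (trans (ℤₚ.neg-distrib-+ (c ℤ.* h u) (linear h p))
             (cong (ℤ._+ ℤ.- linear h p) (ℤₚ.neg-distribˡ-* c (h u))))

linear--P : ∀ h p q → linear h (p -P q) ≡ linear h p ℤ.- linear h q
linear--P h p q = trans (linear-+P h p (negP q)) (cong (ℤ._+_ (linear h p)) (linear-negP h q))

linear-cong : ∀ h h' p → (∀ u → h u ≡ h' u) → linear h p ≡ linear h' p
linear-cong h h' [] e = refl
linear-cong h h' ((c , u) ∷ p) e = cong₂ ℤ._+_ (cong (c ℤ.*_) (e u)) (linear-cong h h' p e)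

linear-zero : ∀ p → linear (λ _ → + 0) p ≡ + 0
linear-zero [] = refl
linear-zero ((c , u) ∷ p) rewrite linear-zero p | ℤₚ.*-zeroʳ c = refl

linear-pointwise- : ∀ h h' p → linear (λ u → h u ℤ.- h' u) p ≡ linear h p ℤ.- linear h' p
linear-pointwise- h h' [] = refl
linear-pointwise- h h' ((c , u) ∷ p) rewrite linear-pointwise- h h' p =
  distrib c (h u) (h' u) (linear h p) (linear h' p)
  where
  distrib : ∀ c a b x y → c ℤ.* (a ℤ.- b) ℤ.+ (x ℤ.- y) ≡ c ℤ.* a ℤ.+ x ℤ.- (c ℤ.* b ℤ.+ y)
  distrib = solve-∀

coeff-+P : ∀ p q m → coeff (p +P q) m ≡ coeff p m ℤ.+ coeff q m
coeff-+P p q m = trans (coeff≡linear (p +P q) m)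
  (trans (linear-+P _ p q) (sym (cong₂ ℤ._+_ (coeff≡linear p m) (coeff≡linear q m))))

coeff--P : ∀ p q m → coeff (p -P q) m ≡ coeff p m ℤ.- coeff q m
coeff--P p q m = trans (coeff≡linear (p -P q) m)
  (trans (linear--P _ p q) (sym (cong₂ ℤ._-_ (coeff≡linear p m) (coeff≡linear q m))))

-P≈0P⇒≈ : ∀ p q → p -P q ≈ 0P → p ≈ q
-P≈0P⇒≈ p q d≈0 m = ℤₚ.i-j≡0⇒i≡j _ _ (trans (sym (coeff--P p q m)) (d≈0 m))

support--P : ∀ p q m → coeff (p -P q) m ≢ + 0 → coeff p m ≢ + 0 ⊎ coeff q m ≢ + 0
support--P p q m nz with coeff p m ℤ.≟ + 0
... | no p≢0 = inj₁ p≢0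
... | yes p≡0 = inj₂ λ q≡0 → nz (trans (coeff--P p q m) (cong₂ ℤ._-_ p≡0 q≡0))

RespNorm : (Mono → ℤ) → Set
RespNorm h = ∀ u u' → norm u ≡ norm u' → h u ≡ h u'

termsAt : Mono → Poly → Poly
termsAt u₀ [] = []
termsAt u₀ ((c , u) ∷ p) with ≡-dec _≟_ (norm u) (norm u₀)
... | yes _ = (c , u) ∷ termsAt u₀ p
... | no _ = termsAt u₀ p

termsOff : Mono → Poly → Poly
termsOff u₀ [] = []
termsOff u₀ ((c , u) ∷ p) with ≡-dec _≟_ (norm u) (norm u₀)
... | yes _ = termsOff u₀ p
... | no _ = (c , u) ∷ termsOff u₀ p

linear-split : ∀ h u₀ p → linear h p ≡ linear h (termsAt u₀ p) ℤ.+ linear h (termsOff u₀ p)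
linear-split h u₀ [] = refl
linear-split h u₀ ((c , u) ∷ p) with ≡-dec _≟_ (norm u) (norm u₀)
... | yes _ rewrite linear-split h u₀ p = sym (ℤₚ.+-assoc (c ℤ.* h u) _ _)
... | no _ rewrite linear-split h u₀ p =
  swap (c ℤ.* h u) (linear h (termsAt u₀ p)) (linear h (termsOff u₀ p))
  where
  swap : ∀ a b d → a ℤ.+ (b ℤ.+ d) ≡ b ℤ.+ (a ℤ.+ d)
  swap = solve-∀

linear-termsAt : ∀ h u₀ p → RespNorm h → linear h (termsAt u₀ p) ≡ coeff p u₀ ℤ.* h u₀
linear-termsAt h u₀ [] r = refl
linear-termsAt h u₀ ((c , u) ∷ p) r with ≡-dec _≟_ (norm u) (norm u₀)
... | yes eq rewrite linear-termsAt h u₀ p r | r u u₀ eq =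
  sym (ℤₚ.*-distribʳ-+ (h u₀) c (coeff p u₀))
... | no _ = linear-termsAt h u₀ p r

coeff-termsOff-≡ : ∀ u₀ p m → norm m ≡ norm u₀ → coeff (termsOff u₀ p) m ≡ + 0
coeff-termsOff-≡ u₀ [] m e = refl
coeff-termsOff-≡ u₀ ((c , u) ∷ p) m e with ≡-dec _≟_ (norm u) (norm u₀)
... | yes _ = coeff-termsOff-≡ u₀ p m e
... | no ne rewrite coeff-∷ c u (termsOff u₀ p) m | monoδ-≢ u m (λ x → ne (trans x e))
                  | coeff-termsOff-≡ u₀ p m e = trans (ℤₚ.+-identityʳ _) (ℤₚ.*-zeroʳ c)

coeff-termsOff-≢ : ∀ u₀ p m → norm m ≢ norm u₀ → coeff (termsOff u₀ p) m ≡ coeff p m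
coeff-termsOff-≢ u₀ [] m ne = refl
coeff-termsOff-≢ u₀ ((c , u) ∷ p) m ne with ≡-dec _≟_ (norm u) (norm u₀)
... | yes eq rewrite coeff-∷ c u p m | monoδ-≢ u m (λ x → ne (trans (sym x) eq))
                   | ℤₚ.*-zeroʳ c | ℤₚ.+-identityˡ (coeff p m) = coeff-termsOff-≢ u₀ p m ne
... | no _ rewrite coeff-∷ c u (termsOff u₀ p) m | coeff-∷ c u p m
                 | coeff-termsOff-≢ u₀ p m ne = refl

length-termsOff : ∀ u₀ p → length (termsOff u₀ p) ≤ length p
length-termsOff u₀ [] = z≤n
length-termsOff u₀ ((c , u) ∷ p) with ≡-dec _≟_ (norm u) (norm u₀)
... | yes _ = m≤n⇒m≤1+n (length-termsOff u₀ p)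
... | no _ = s≤s (length-termsOff u₀ p)

length-termsOff-head : ∀ c u p → length (termsOff u ((c , u) ∷ p)) ≤ length p
length-termsOff-head c u p with ≡-dec _≟_ (norm u) (norm u)
... | yes _ = length-termsOff u p
... | no ne = ⊥-elim (ne refl)

-- A term list may repeat monomials, so all terms at the head monomial are
-- removed at once.
linear-vanish : ∀ p h → RespNorm h → (∀ u → coeff p u ≢ + 0 → h u ≡ + 0) → linear h p ≡ + 0
linear-vanish p h = go (length p) p h ≤-refl
  where
  go : ∀ n p h → length p ≤ n → RespNorm h →
       (∀ u → coeff p u ≢ + 0 → h u ≡ + 0) → linear h p ≡ + 0
  go n [] h le r hyp = refl
  go (suc n) ((c , u) ∷ p) h (s≤s le) r hyp =
    trans (linear-split h u P)
      (trans (cong₂ ℤ._+_ (linear-termsAt h u P r) rest) (trans (ℤₚ.+-identityʳ _) head))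
    where
    P = (c , u) ∷ p
    head : coeff P u ℤ.* h u ≡ + 0
    head with coeff P u ℤ.≟ + 0
    ... | yes z = cong (ℤ._* h u) z
    ... | no nz = trans (cong (coeff P u ℤ.*_) (hyp u nz)) (ℤₚ.*-zeroʳ (coeff P u))
    rest : linear h (termsOff u P) ≡ + 0
    rest = go n (termsOff u P) h (≤-trans (length-termsOff-head c u p) le) r hyp'
      where
      hyp' : ∀ v → coeff (termsOff u P) v ≢ + 0 → h v ≡ + 0
      hyp' v nz with ≡-dec _≟_ (norm v) (norm u)
      ... | yes eq = ⊥-elim (nz (coeff-termsOff-≡ u P v eq))
      ... | no ne = hyp v (λ z → nz (trans (coeff-termsOff-≢ u P v ne) z))

linear-cong-off : ∀ h p q → RespNorm h → (∀ u → coeff p u ≢ coeff q u → h u ≡ + 0) →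
                  linear h p ≡ linear h q
linear-cong-off h p q r hyp =
  ℤₚ.i-j≡0⇒i≡j _ _ (trans (sym (linear--P h p q)) (linear-vanish (p -P q) h r hyp'))
  where
  hyp' : ∀ u → coeff (p -P q) u ≢ + 0 → h u ≡ + 0
  hyp' u nz = hyp u (λ e → nz (trans (coeff--P p q u) (ℤₚ.i≡j⇒i-j≡0 e)))

linear-cong-≈ : ∀ h p q → RespNorm h → p ≈ q → linear h p ≡ linear h q
linear-cong-≈ h p q r e = linear-cong-off h p q r (λ u ne → ⊥-elim (ne (e u)))

linear-cong-support : ∀ h h' p → RespNorm h → RespNorm h' →
                      (∀ u → coeff p u ≢ + 0 → h u ≡ h' u) → linear h p ≡ linear h' p
linear-cong-support h h' p r r' hyp = ℤₚ.i-j≡0⇒i≡j _ _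
  (trans (sym (linear-pointwise- h h' p))
         (linear-vanish p _ r- (λ u nz → ℤₚ.i≡j⇒i-j≡0 (hyp u nz))))
  where
  r- : RespNorm (λ u → h u ℤ.- h' u)
  r- u u' e = cong₂ ℤ._-_ (r u u' e) (r' u u' e)

-- Products and substitutions

RespNorm-monoMulʳ : ∀ u m → RespNorm (λ v → monoδ (monoMul u v) m)
RespNorm-monoMulʳ u m v v' e = monoδ-normˡ (monoMul u v) (monoMul u v') m (monoMul-normʳ u v v' e)

RespNorm-monoMulˡ : ∀ q m → RespNorm (λ u → linear (λ v → monoδ (monoMul u v) m) q)
RespNorm-monoMulˡ q m u u' e =
  linear-cong _ _ q (λ v → monoδ-normˡ (monoMul u v) (monoMul u' v) m (monoMul-normˡ u u' v e))

coeff-map-scale : ∀ (g : ℤ × Mono → ℤ × Mono) c u q m → (∀ d v → g (d , v) ≡ (c ℤ.* d , monoMul u v)) →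
                  coeff (map g q) m ≡ c ℤ.* linear (λ v → monoδ (monoMul u v) m) q
coeff-map-scale g c u [] m g≡ = sym (ℤₚ.*-zeroʳ c)
coeff-map-scale g c u ((d , v) ∷ q) m g≡
  rewrite g≡ d v | coeff-∷ (c ℤ.* d) (monoMul u v) (map g q) m | coeff-map-scale g c u q m g≡ =
  distrib c d (monoδ (monoMul u v) m) (linear (λ v → monoδ (monoMul u v) m) q)
  where
  distrib : ∀ c d a x → c ℤ.* d ℤ.* a ℤ.+ c ℤ.* x ≡ c ℤ.* (d ℤ.* a ℤ.+ x)
  distrib = solve-∀

coeff-*P : ∀ p q m → coeff (p *P q) m ≡ linear (λ u → linear (λ v → monoδ (monoMul u v) m) q) p
coeff-*P [] q m = refl
coeff-*P ((c , u) ∷ p) q m =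
  trans (coeff-+P (map _ q) (p *P q) m) (cong₂ ℤ._+_ (coeff-map-scale _ c u q m (λ _ _ → refl)) (coeff-*P p q m))

*P-congʳ : ∀ p q q' → q ≈ q' → p *P q ≈ p *P q'
*P-congʳ p q q' e m = trans (coeff-*P p q m)
  (trans (linear-cong _ _ p (λ u → linear-cong-≈ _ q q' (RespNorm-monoMulʳ u m) e))
         (sym (coeff-*P p q' m)))

coeff-const-*P : ∀ c x m → coeff (const c *P x) m ≡ c ℤ.* coeff x m
coeff-const-*P c x m = trans (coeff-+P (map _ x) [] m)
  (trans (ℤₚ.+-identityʳ _) (trans (coeff-map-scale _ c [] x m (λ _ _ → refl)) (cong (c ℤ.*_) (sym (coeff≡linear x m)))))

coeff-eval : ∀ s p m → coeff (eval s p) m ≡ linear (λ u → coeff (evalMono s u) m) p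
coeff-eval s [] m = refl
coeff-eval s ((c , u) ∷ p) m = trans (coeff-+P (const c *P evalMono s u) (eval s p) m)
  (cong₂ ℤ._+_ (coeff-const-*P c (evalMono s u) m) (coeff-eval s p m))

evalMono-cons0 : ∀ s e x → evalMono s (cons0 e x) ≈ evalMono s (e ∷ x)
evalMono-cons0 s zero [] m = refl
evalMono-cons0 s zero (y ∷ ys) m = refl
evalMono-cons0 s (suc e) x m = refl

evalMono-norm : ∀ s u → evalMono s u ≈ evalMono s (norm u)
evalMono-norm s [] m = refl
evalMono-norm s (e ∷ es) m =
  trans (*P-congʳ (s 0 ^P e) _ _ (evalMono-norm (λ j → s (suc j)) es) m)
        (sym (evalMono-cons0 s e (norm es) m))

RespNorm-evalMono : ∀ s m → RespNorm (λ u → coeff (evalMono s u) m)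
RespNorm-evalMono s m u u' e = trans (evalMono-norm s u m)
  (trans (cong (λ x → coeff (evalMono s x) m) e) (sym (evalMono-norm s u' m)))

substMono : (ℕ → Mono) → Mono → Mono
substMono τ [] = []
substMono τ (e ∷ es) = monoMul (mpow (τ 0) e) (substMono (λ l → τ (suc l)) es)

expo-substMono : ∀ τ w k → expo (substMono τ w) k ≡ weight w (λ l → expo (τ l) k)
expo-substMono τ [] k = refl
expo-substMono τ (e ∷ es) k = trans (expo-monoMul (mpow (τ 0) e) _ k)
  (cong₂ _+_ (expo-mpow (τ 0) e k) (expo-substMono (λ l → τ (suc l)) es k))

weight-substMono : ∀ τ w f → weight (substMono τ w) f ≡ weight w (λ l → weight (τ l) f)
weight-substMono τ [] f = refl
weight-substMono τ (e ∷ es) f = trans (weight-monoMul (mpow (τ 0) e) _ f)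
  (cong₂ _+_ (weight-mpow (τ 0) e f) (weight-substMono (λ l → τ (suc l)) es f))

single-^P : ∀ u e → ((+ 1 , u) ∷ []) ^P e ≡ (+ 1 , mpow u e) ∷ []
single-^P u zero = refl
single-^P u (suc e) rewrite single-^P u e = refl

evalMono-monomial : ∀ w t τ → (∀ l → expo w l ≢ 0 → t l ≡ (+ 1 , τ l) ∷ []) →
                    evalMono t w ≡ (+ 1 , substMono τ w) ∷ []
evalMono-monomial [] t τ h = refl
evalMono-monomial (zero ∷ es) t τ h
  rewrite evalMono-monomial es (λ l → t (suc l)) (λ l → τ (suc l)) (λ l → h (suc l)) = refl
evalMono-monomial (suc e ∷ es) t τ h
  rewrite h 0 (λ ()) | single-^P (τ 0) (suc e)
        | evalMono-monomial es (λ l → t (suc l)) (λ l → τ (suc l)) (λ l → h (suc l)) = refl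

-- Weight bounds and top parts

module Weighted (ω : ℕ → ℕ) where

  wt : Mono → ℕ
  wt m = weight m ω

  WtLe : Poly → ℕ → Set
  WtLe p d = ∀ m → d < wt m → coeff p m ≡ + 0

  AgreeFrom : Poly → Poly → ℕ → Set
  AgreeFrom p q d = ∀ m → d ≤ wt m → coeff p m ≡ coeff q m

  SameTop : Poly → Poly → ℕ → Set
  SameTop p q d = WtLe p d × WtLe q d × AgreeFrom p q d

  WtLe-support : ∀ p d → WtLe p d → ∀ u → coeff p u ≢ + 0 → wt u ≤ d
  WtLe-support p d B u nz with wt u ≤? d
  ... | yes le = le
  ... | no nle = ⊥-elim (nz (B u (≰⇒> nle)))

  monoδ-wt≢ : ∀ u m → wt u ≢ wt m → monoδ u m ≡ + 0
  monoδ-wt≢ u m ne = monoδ-≢ u m (λ e → ne (norm≡⇒weight≡ u m ω e))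

  wt-monoMul : ∀ u v → wt (monoMul u v) ≡ wt u + wt v
  wt-monoMul u v = weight-monoMul u v ω

  WtLe-single : ∀ c u → WtLe ((c , u) ∷ []) (wt u)
  WtLe-single c u m lt rewrite coeff-∷ c u [] m | monoδ-wt≢ u m (<⇒≢ lt) =
    trans (ℤₚ.+-identityʳ _) (ℤₚ.*-zeroʳ c)

  WtLe-+P : ∀ p q d → WtLe p d → WtLe q d → WtLe (p +P q) d
  WtLe-+P p q d Bp Bq m lt rewrite coeff-+P p q m | Bp m lt | Bq m lt = refl

  WtLe-mono : ∀ p d d' → d ≤ d' → WtLe p d → WtLe p d'
  WtLe-mono p d d' le B m lt = B m (≤-<-trans le lt)

  WtLe-1P : WtLe 1P 0
  WtLe-1P = WtLe-single (+ 1) []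

  WtLe-*P : ∀ p q d₁ d₂ → WtLe p d₁ → WtLe q d₂ → WtLe (p *P q) (d₁ + d₂)
  WtLe-*P p q d₁ d₂ Bp Bq m lt = trans (coeff-*P p q m)
    (linear-vanish p _ (RespNorm-monoMulˡ q m) λ u nzu →
      linear-vanish q _ (RespNorm-monoMulʳ u m) λ v nzv →
        monoδ-wt≢ (monoMul u v) m (<⇒≢ (≤-<-trans (wt-uv≤ u v nzu nzv) lt)))
    where
    wt-uv≤ : ∀ u v → coeff p u ≢ + 0 → coeff q v ≢ + 0 → wt (monoMul u v) ≤ d₁ + d₂
    wt-uv≤ u v nzu nzv = ≤-trans (≤-reflexive (wt-monoMul u v))
      (+-mono-≤ (WtLe-support p d₁ Bp u nzu) (WtLe-support q d₂ Bq v nzv))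

  AgreeFrom-support : ∀ p q d → AgreeFrom p q d → ∀ u → coeff p u ≢ coeff q u → wt u < d
  AgreeFrom-support p q d A u ne with d ≤? wt u
  ... | yes le = ⊥-elim (ne (A u le))
  ... | no nle = ≰⇒> nle

  AgreeFrom-*P : ∀ p q p' q' d₁ d₂ → WtLe q d₂ → WtLe p' d₁ →
                 AgreeFrom p p' d₁ → AgreeFrom q q' d₂ → AgreeFrom (p *P q) (p' *P q') (d₁ + d₂)
  AgreeFrom-*P p q p' q' d₁ d₂ Bq Bp' Ap Aq m le = begin
    coeff (p *P q) m                                 ≡⟨ coeff-*P p q m ⟩
    linear (λ u → linear (λ v → δuv u v) q) p        ≡⟨ change-p ⟩
    linear (λ u → linear (λ v → δuv u v) q) p'       ≡⟨ change-q ⟩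
    linear (λ u → linear (λ v → δuv u v) q') p'      ≡⟨ sym (coeff-*P p' q' m) ⟩
    coeff (p' *P q') m                               ∎
    where
    open ≡-Reasoning
    δuv : Mono → Mono → ℤ
    δuv u v = monoδ (monoMul u v) m
    too-light : ∀ u v → wt u + wt v < d₁ + d₂ → δuv u v ≡ + 0
    too-light u v lt = monoδ-wt≢ (monoMul u v) m
      (<⇒≢ (<-≤-trans (≤-<-trans (≤-reflexive (wt-monoMul u v)) lt) le))
    change-p = linear-cong-off _ p p' (RespNorm-monoMulˡ q m) λ u ne →
      linear-vanish q _ (RespNorm-monoMulʳ u m) λ v nz → too-light u v
        (+-mono-<-≤ (AgreeFrom-support p p' d₁ Ap u ne) (WtLe-support q d₂ Bq v nz))
    change-q = linear-cong-support _ _ p' (RespNorm-monoMulˡ q m) (RespNorm-monoMulˡ q' m) λ u nz →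
      linear-cong-off _ q q' (RespNorm-monoMulʳ u m) λ v ne → too-light u v
        (+-mono-≤-< (WtLe-support p' d₁ Bp' u nz) (AgreeFrom-support q q' d₂ Aq v ne))

  SameTop-*P : ∀ p q p' q' d₁ d₂ → SameTop p p' d₁ → SameTop q q' d₂ →
               SameTop (p *P q) (p' *P q') (d₁ + d₂)
  SameTop-*P p q p' q' d₁ d₂ (Bp , Bp' , Ap) (Bq , Bq' , Aq) =
    WtLe-*P p q d₁ d₂ Bp Bq , WtLe-*P p' q' d₁ d₂ Bp' Bq' , AgreeFrom-*P p q p' q' d₁ d₂ Bq Bp' Ap Aq

  SameTop-1P : SameTop 1P 1P 0
  SameTop-1P = WtLe-1P , WtLe-1P , (λ m _ → refl)

  SameTop-^P : ∀ p q d → SameTop p q d → ∀ e → SameTop (p ^P e) (q ^P e) (e * d)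
  SameTop-^P p q d T zero = SameTop-1P
  SameTop-^P p q d T (suc e) = SameTop-*P p (p ^P e) q (q ^P e) d (e * d) T (SameTop-^P p q d T e)

  SameTop-evalMono : ∀ w s t β → (∀ j → SameTop (s j) (t j) (β j)) →
                     SameTop (evalMono s w) (evalMono t w) (weight w β)
  SameTop-evalMono [] s t β T = SameTop-1P
  SameTop-evalMono (e ∷ es) s t β T =
    SameTop-*P (s 0 ^P e) _ (t 0 ^P e) _ (e * β 0) _ (SameTop-^P (s 0) (t 0) (β 0) (T 0) e)
      (SameTop-evalMono es (λ j → s (suc j)) (λ j → t (suc j)) (λ j → β (suc j)) (λ j → T (suc j)))

  topPart : ℕ → Poly → Poly
  topPart d [] = []
  topPart d ((c , u) ∷ p) with wt u ≟ d
  ... | yes _ = (c , u) ∷ topPart d p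
  ... | no _ = topPart d p

  coeff-topPart-≡ : ∀ d p m → wt m ≡ d → coeff (topPart d p) m ≡ coeff p m
  coeff-topPart-≡ d [] m e = refl
  coeff-topPart-≡ d ((c , u) ∷ p) m e with wt u ≟ d
  ... | yes _ rewrite coeff-∷ c u (topPart d p) m | coeff-∷ c u p m | coeff-topPart-≡ d p m e = refl
  ... | no ne rewrite coeff-∷ c u p m | monoδ-wt≢ u m (λ x → ne (trans x e))
                    | ℤₚ.*-zeroʳ c | ℤₚ.+-identityˡ (coeff p m) = coeff-topPart-≡ d p m e

  coeff-topPart-≢ : ∀ d p m → wt m ≢ d → coeff (topPart d p) m ≡ + 0
  coeff-topPart-≢ d [] m ne = refl
  coeff-topPart-≢ d ((c , u) ∷ p) m ne with wt u ≟ d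
  ... | yes e rewrite coeff-∷ c u (topPart d p) m | monoδ-wt≢ u m (λ x → ne (trans (sym x) e))
                    | ℤₚ.*-zeroʳ c | ℤₚ.+-identityˡ (coeff (topPart d p) m) = coeff-topPart-≢ d p m ne
  ... | no _ = coeff-topPart-≢ d p m ne

  SameTop-topPart : ∀ p d → WtLe p d → SameTop p (topPart d p) d
  SameTop-topPart p d B = B , (λ m lt → coeff-topPart-≢ d p m (λ e → <⇒≢ lt (sym e))) , agree
    where
    agree : AgreeFrom p (topPart d p) d
    agree m le with wt m ≟ d
    ... | yes e = sym (coeff-topPart-≡ d p m e)
    ... | no ne = trans (B m (≤∧≢⇒< le (λ e → ne (sym e)))) (sym (coeff-topPart-≢ d p m ne))

  topPart-pair₁ : ∀ d c₀ u₀ c₁ u₁ → wt u₀ ≡ d → wt u₁ ≢ d →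
                  topPart d ((c₀ , u₀) ∷ (c₁ , u₁) ∷ []) ≡ (c₀ , u₀) ∷ []
  topPart-pair₁ d c₀ u₀ c₁ u₁ e₀ n₁ with wt u₀ ≟ d
  ... | no n₀ = ⊥-elim (n₀ e₀)
  ... | yes _ with wt u₁ ≟ d
  ...   | yes e₁ = ⊥-elim (n₁ e₁)
  ...   | no _ = refl

  topPart-pair₂ : ∀ d c₀ u₀ c₁ u₁ → wt u₀ ≢ d → wt u₁ ≡ d →
                  topPart d ((c₀ , u₀) ∷ (c₁ , u₁) ∷ []) ≡ (c₁ , u₁) ∷ []
  topPart-pair₂ d c₀ u₀ c₁ u₁ n₀ e₁ with wt u₀ ≟ d
  ... | yes e₀ = ⊥-elim (n₀ e₀)
  ... | no _ with wt u₁ ≟ d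
  ...   | no n₁ = ⊥-elim (n₁ e₁)
  ...   | yes _ = refl

  ωprev : ℕ → ℕ
  ωprev zero = 0
  ωprev (suc k) = ω k

  β : ℕ → ℕ
  β k = ω k ⊔ ωprev k

  WtLe-σ : ∀ l → WtLe (σ l) (ωprev l)
  WtLe-σ zero = WtLe-1P
  WtLe-σ (suc l) = subst (WtLe (var l)) (weight-unitMono l ω) (WtLe-single (+ 1) (unitMono l))

  WtLe-shift : ∀ j → WtLe (shift j) (β j)
  WtLe-shift j = WtLe-+P (σ j) (σ (suc j)) (β j)
    (WtLe-mono (σ j) (ωprev j) (β j) (m≤n⊔m (ω j) (ωprev j)) (WtLe-σ j))
    (WtLe-mono (σ (suc j)) (ω j) (β j) (m≤m⊔n (ω j) (ωprev j)) (WtLe-σ (suc j)))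

  shiftTop : ℕ → Poly
  shiftTop j = topPart (β j) (shift j)

  SameTop-evalMono-shift : ∀ w → SameTop (evalMono shift w) (evalMono shiftTop w) (weight w β)
  SameTop-evalMono-shift w =
    SameTop-evalMono w shift shiftTop β (λ j → SameTop-topPart (shift j) (β j) (WtLe-shift j))

-- Shift-invariant polynomials

-- expo m j is the exponent of σ (suc j), so HasVarAbove N m says that m
-- contains a variable of degree > N.
HasVarAbove : ℕ → Mono → Set
HasVarAbove N m = Σ ℕ λ j → N ≤ j × expo m j ≢ 0

sum≤double⇒< : ∀ N a b → N ≤ a → b + suc a ≤ N + N → b < N
sum≤double⇒< N a b N≤a sum≤ = +-cancelˡ-≤ N (suc b) N (begin
  N + suc b   ≡⟨ +-suc N b ⟩
  suc (N + b) ≤⟨ s≤s (+-monoˡ-≤ b N≤a) ⟩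
  suc (a + b) ≡⟨ cong suc (+-comm a b) ⟩
  suc (b + a) ≡⟨ sym (+-suc b a) ⟩
  b + suc a   ≤⟨ sum≤ ⟩
  N + N       ∎)
  where open ≤-Reasoning

module Vanishing (n : ℕ) (D : Poly)
  (light : ∀ m → coeff D m ≢ + 0 → weight m suc ≤ suc n + suc n)
  (heavy : ∀ m → coeff D m ≢ + 0 → HasVarAbove (suc n) m)
  (fixed : ∀ m → coeff D m ≡ linear (λ u → coeff (evalMono shift u) m) D) where

  N : ℕ
  N = suc n

  other-vars-small : ∀ w j k → coeff D w ≢ + 0 → N ≤ j → expo w j ≢ 0 → expo w k ≢ 0 → k ≢ j →
                     suc k < N
  other-vars-small w j k nz N≤j ej ek k≢j = sum≤double⇒< N j (suc k) N≤j (begin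
    suc k + suc j                          ≡⟨ +-comm (suc k) (suc j) ⟩
    suc j + suc k                          ≤⟨ +-mono-≤ (m≤n*m (suc j) (expo w j) ⦃ ≢-nonZero ej ⦄)
                                                       (m≤n*m (suc k) (expo w k) ⦃ ≢-nonZero ek ⦄) ⟩
    expo w j * suc j + expo w k * suc k    ≤⟨ two-terms≤weight w suc j k k≢j ⟩
    weight w suc                           ≤⟨ light w nz ⟩
    N + N                                  ∎)
    where open ≤-Reasoning

  NoVar : ℕ → Set
  NoVar i = ∀ m → expo m i ≢ 0 → coeff D m ≡ + 0

  noVar-n : NoVar n
  noVar-n m en with coeff D m ℤ.≟ + 0
  ... | yes z = z
  ... | no nz with heavy m nz
  ...   | (j , N≤j , ej) = ⊥-elim (<-irrefl refl (other-vars-small m j n nz N≤j ej en (<⇒≢ N≤j)))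

  -- Knowing that no monomial of D contains σ (suc i), we show the same for
  -- σ (suc (suc i)). Let lower m replace σ (suc (suc i)) by σ (suc i), and weigh
  -- σ (suc i) by N, the small variables σ (suc k) (k < n) by their degree and
  -- all others by 0. For a monomial m of D containing σ (suc (suc i)), lower m
  -- is the top part of shift m, and it is not a top part of shift w for any
  -- other w of height ≤ height m; so the coefficient of lower m in D = shift D,
  -- which vanishes, is that of m, once heavier such m are known to vanish.
  module Step (i : ℕ) (n≤i : n ≤ i) (noVar-i : NoVar i) where

    ω : ℕ → ℕ
    ω k with k ≟ i
    ... | yes _ = N
    ... | no _ with suc k <? N
    ...   | yes _ = suc k
    ...   | no _ = 0

    ω-i : ω i ≡ N
    ω-i with i ≟ i
    ... | yes _ = refl
    ... | no ne = ⊥-elim (ne refl)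

    ω-small : ∀ k → suc k < N → ω k ≡ suc k
    ω-small k lt with k ≟ i
    ... | yes refl = ⊥-elim (<-irrefl refl (≤-<-trans (s≤s n≤i) lt))
    ... | no _ with suc k <? N
    ...   | yes _ = refl
    ...   | no nl = ⊥-elim (nl lt)

    ω-large : ∀ k → k ≢ i → ¬ (suc k < N) → ω k ≡ 0
    ω-large k ne nl with k ≟ i
    ... | yes e = ⊥-elim (ne e)
    ... | no _ with suc k <? N
    ...   | yes l = ⊥-elim (nl l)
    ...   | no _ = refl

    ω≤suc : ∀ k → ω k ≤ suc k
    ω≤suc k with k ≟ i
    ... | yes refl = s≤s n≤i
    ... | no _ with suc k <? N
    ...   | yes _ = ≤-refl
    ...   | no _ = z≤n

    open Weighted ω

    β≤suc : ∀ k → β k ≤ suc k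
    β≤suc k = ⊔-lub (ω≤suc k) (ωprev≤suc k)
      where
      ωprev≤suc : ∀ k → ωprev k ≤ suc k
      ωprev≤suc zero = z≤n
      ωprev≤suc (suc k) = ≤-trans (ω≤suc k) (n≤1+n _)

    ¬small : ∀ k → N ≤ k → ¬ (suc k < N)
    ¬small k le lt = <-irrefl refl (<-≤-trans (<-trans (n<1+n k) lt) le)

    β-suc-i : β (suc i) ≡ N
    β-suc-i rewrite ω-large (suc i) 1+n≢n (¬small (suc i) (s≤s n≤i)) | ω-i = refl

    ωprev-small : ∀ k → suc k < N → ωprev k ≡ k
    ωprev-small zero _ = refl
    ωprev-small (suc k) lt = ω-small k (<-trans (n<1+n (suc k)) lt)

    β-small : ∀ k → suc k < N → β k ≡ suc k
    β-small k lt rewrite ω-small k lt | ωprev-small k lt = m≥n⇒m⊔n≡m (n≤1+n k)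

    β-large : ∀ j → N ≤ j → j ≢ i → j ≢ suc i → β j ≡ 0
    β-large (suc j) le ne₁ ne₂
      rewrite ω-large (suc j) ne₁ (¬small (suc j) le)
            | ω-large j (λ e → ne₂ (cong suc e)) (λ lt → <-irrefl refl (<-≤-trans lt le)) = refl

    height : Mono → ℕ
    height m = weight m β

    lowerIndex : ℕ → ℕ
    lowerIndex l with l ≟ suc i
    ... | yes _ = i
    ... | no _ = l

    lowerVar : ℕ → Mono
    lowerVar l = unitMono (lowerIndex l)

    lower : Mono → Mono
    lower = substMono lowerVar

    expo-lower-other : ∀ w k → k ≢ i → k ≢ suc i → expo (lower w) k ≡ expo w k
    expo-lower-other w k k≢i k≢si = trans (expo-substMono lowerVar w k)
      (trans (weight-cong-≗ w _ _ λ l → trans (expo-unitMono (lowerIndex l) k) (δ-lowerIndex l))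
             (weight-δ w k))
      where
      δ-lowerIndex : ∀ l → δ (lowerIndex l) k ≡ δ l k
      δ-lowerIndex l with l ≟ suc i
      ... | yes refl = trans (δ-≢ i k (λ e → k≢i (sym e))) (sym (δ-≢ (suc i) k (λ e → k≢si (sym e))))
      ... | no _ = refl

    expo-lower-i : ∀ w → expo (lower w) i ≡ expo w i + expo w (suc i)
    expo-lower-i w = trans (expo-substMono lowerVar w i)
      (trans (weight-cong-≗ w _ _ λ l → trans (expo-unitMono (lowerIndex l) i) (δ-lowerIndex l))
      (trans (weight-+ w _ _) (cong₂ _+_ (weight-δ w i) (weight-δ w (suc i)))))
      where
      δ-lowerIndex : ∀ l → δ (lowerIndex l) i ≡ δ l i + δ l (suc i)
      δ-lowerIndex l with l ≟ suc i
      ... | yes refl = trans (δ-diag i) (sym (cong₂ _+_ (δ-≢ (suc i) i 1+n≢n) (δ-diag (suc i))))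
      ... | no ne rewrite δ-≢ l (suc i) ne = sym (+-identityʳ _)

    lower-norm : ∀ w m → norm w ≡ norm m → norm (lower w) ≡ norm (lower m)
    lower-norm w m e = expo≗⇒norm≡ (lower w) (lower m) λ k →
      trans (expo-substMono lowerVar w k) (trans (norm≡⇒weight≡ w m _ e) (sym (expo-substMono lowerVar m k)))

    lower-injective : ∀ w m → expo w i ≡ 0 → expo m i ≡ 0 → norm (lower w) ≡ norm (lower m) →
                      norm w ≡ norm m
    lower-injective w m ew em e = expo≗⇒norm≡ w m same
      where
      same : ∀ k → expo w k ≡ expo m k
      same k with k ≟ i
      ... | yes refl = trans ew (sym em)
      ... | no k≢i with k ≟ suc i
      ...   | yes refl = begin
              expo w (suc i)              ≡⟨ cong (_+ expo w (suc i)) (sym ew) ⟩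
              expo w i + expo w (suc i)   ≡⟨ sym (expo-lower-i w) ⟩
              expo (lower w) i            ≡⟨ norm≡⇒expo≗ (lower w) (lower m) e i ⟩
              expo (lower m) i            ≡⟨ expo-lower-i m ⟩
              expo m i + expo m (suc i)   ≡⟨ cong (_+ expo m (suc i)) em ⟩
              expo m (suc i)              ∎
        where open ≡-Reasoning
      ...   | no k≢si = trans (sym (expo-lower-other w k k≢i k≢si))
                        (trans (norm≡⇒expo≗ (lower w) (lower m) e k) (expo-lower-other m k k≢i k≢si))

    σMono : ℕ → Mono
    σMono zero = []
    σMono (suc j) = unitMono j

    shift-σMono : ∀ l → shift l ≡ (+ 1 , σMono l) ∷ (+ 1 , unitMono l) ∷ []
    shift-σMono zero = refl
    shift-σMono (suc l) = refl

    wt-σMono : ∀ l → wt (σMono l) ≡ ωprev l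
    wt-σMono zero = refl
    wt-σMono (suc l) = weight-unitMono l ω

    shiftTop-small : ∀ l → suc l < N → shiftTop l ≡ (+ 1 , unitMono l) ∷ []
    shiftTop-small l lt = trans (cong (topPart (β l)) (shift-σMono l))
      (topPart-pair₂ (β l) (+ 1) (σMono l) (+ 1) (unitMono l) lower≢ upper≡)
      where
      lower≢ : wt (σMono l) ≢ β l
      lower≢ e = 1+n≢n (sym (trans (sym (trans (wt-σMono l) (ωprev-small l lt))) (trans e (β-small l lt))))
      upper≡ : wt (unitMono l) ≡ β l
      upper≡ = trans (weight-unitMono l ω) (trans (ω-small l lt) (sym (β-small l lt)))

    shiftTop-suc-i : shiftTop (suc i) ≡ (+ 1 , unitMono i) ∷ []
    shiftTop-suc-i = topPart-pair₁ (β (suc i)) (+ 1) (unitMono i) (+ 1) (unitMono (suc i)) lower≡ upper≢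
      where
      lower≡ : wt (unitMono i) ≡ β (suc i)
      lower≡ = trans (weight-unitMono i ω) (trans ω-i (sym β-suc-i))
      upper≢ : wt (unitMono (suc i)) ≢ β (suc i)
      upper≢ e with trans (sym (trans (weight-unitMono (suc i) ω)
                                      (ω-large (suc i) 1+n≢n (¬small (suc i) (s≤s n≤i))))) (trans e β-suc-i)
      ... | ()

    evalMono-shiftTop : ∀ w → coeff D w ≢ + 0 → expo w (suc i) ≢ 0 →
                        evalMono shiftTop w ≡ (+ 1 , lower w) ∷ []
    evalMono-shiftTop w nz es = evalMono-monomial w shiftTop lowerVar on-support
      where
      on-support : ∀ l → expo w l ≢ 0 → shiftTop l ≡ (+ 1 , lowerVar l) ∷ []
      on-support l el with l ≟ suc i
      ... | yes refl = shiftTop-suc-i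
      ... | no ne =
        shiftTop-small l (other-vars-small w (suc i) l nz (s≤s n≤i) es el ne)

    wt-lower : ∀ m → coeff D m ≢ + 0 → expo m (suc i) ≢ 0 → wt (lower m) ≡ height m
    wt-lower m nz es = trans (weight-substMono lowerVar m ω)
      (trans (weight-cong-≗ m _ _ (λ l → weight-unitMono (lowerIndex l) ω)) (weight-cong m _ _ ω∘lowerIndex))
      where
      ω∘lowerIndex : ∀ l → expo m l * ω (lowerIndex l) ≡ expo m l * β l
      ω∘lowerIndex l with l ≟ suc i
      ... | yes refl = cong (expo m (suc i) *_) (trans ω-i (sym β-suc-i))
      ... | no ne with expo m l ≟ 0
      ...   | yes z rewrite z = refl
      ...   | no el = cong (expo m l *_) (trans (ω-small l small) (sym (β-small l small)))
        where small = other-vars-small m (suc i) l nz (s≤s n≤i) es el ne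

    lacks-suc-i⇒height< : ∀ w → coeff D w ≢ + 0 → expo w i ≡ 0 → expo w (suc i) ≡ 0 → height w < N
    lacks-suc-i⇒height< w nz ei esi with heavy w nz
    ... | (j , N≤j , ej) = sum≤double⇒< N j (height w) N≤j (begin
      height w + suc j                 ≤⟨ +-monoʳ-≤ (height w) (m≤n*m (suc j) (expo w j) ⦃ ≢-nonZero ej ⦄) ⟩
      height w + expo w j * suc j      ≤⟨ weight-extract w β suc j (λ k _ → β≤suc k) β-j ⟩
      weight w suc                     ≤⟨ light w nz ⟩
      N + N                            ∎)
      where
      open ≤-Reasoning
      β-j : β j ≡ 0
      β-j = β-large j N≤j (λ { refl → ej ei }) (λ { refl → ej esi })

    expo-i≡0 : ∀ u → coeff D u ≢ + 0 → expo u i ≡ 0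
    expo-i≡0 u nz with expo u i ≟ 0
    ... | yes e = e
    ... | no ne = ⊥-elim (nz (noVar-i u ne))

    lower-has-i : ∀ m → coeff D m ≢ + 0 → expo m (suc i) ≢ 0 → expo (lower m) i ≢ 0
    lower-has-i m nz es e = es (begin
      expo m (suc i)              ≡⟨ cong (_+ expo m (suc i)) (sym (expo-i≡0 m nz)) ⟩
      expo m i + expo m (suc i)   ≡⟨ sym (expo-lower-i m) ⟩
      expo (lower m) i            ≡⟨ e ⟩
      0                           ∎)
      where open ≡-Reasoning

    coeff-shift-light : ∀ w u → height w < wt u → coeff (evalMono shift w) u ≡ + 0
    coeff-shift-light w u = proj₁ (SameTop-evalMono-shift w) u

    coeff-shift-at-lower : ∀ m → coeff D m ≢ + 0 → expo m (suc i) ≢ 0 →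
      (∀ w → expo w (suc i) ≢ 0 → height m < height w → coeff D w ≡ + 0) →
      ∀ w → coeff D w ≢ + 0 → coeff (evalMono shift w) (lower m) ≡ monoδ w m
    coeff-shift-at-lower m nzm esm heavier w nzw with expo w (suc i) ≟ 0
    ... | yes esw = trans (coeff-shift-light w (lower m) (<-≤-trans light-w N≤wt-lower-m))
                          (sym (monoδ-≢ w m λ e → esm (trans (sym (norm≡⇒expo≗ w m e (suc i))) esw)))
      where
      light-w : height w < N
      light-w = lacks-suc-i⇒height< w nzw (expo-i≡0 w nzw) esw
      N≤wt-lower-m : N ≤ wt (lower m)
      N≤wt-lower-m = ≤-trans (m≤n*m N (expo (lower m) i) ⦃ ≢-nonZero (lower-has-i m nzm esm) ⦄)
        (subst (λ x → expo (lower m) i * x ≤ wt (lower m)) ω-i (term≤weight (lower m) ω i))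
    ... | no esw with <-cmp (height w) (height m)
    ...   | tri< lt _ _ = trans (coeff-shift-light w (lower m) (subst (height w <_) (sym (wt-lower m nzm esm)) lt))
                                (sym (monoδ-≢ w m λ e → <⇒≢ lt (norm≡⇒weight≡ w m β e)))
    ...   | tri> _ _ gt = ⊥-elim (nzw (heavier w esw gt))
    ...   | tri≈ _ eq _ = begin
      coeff (evalMono shift w) (lower m)      ≡⟨ proj₂ (proj₂ (SameTop-evalMono-shift w)) (lower m)
                                                   (≤-reflexive (trans eq (sym (wt-lower m nzm esm)))) ⟩
      coeff (evalMono shiftTop w) (lower m)   ≡⟨ cong (λ p → coeff p (lower m)) (evalMono-shiftTop w nzw esw) ⟩
      coeff ((+ 1 , lower w) ∷ []) (lower m)  ≡⟨ trans (coeff-∷ (+ 1) (lower w) [] (lower m))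
                                                       (trans (ℤₚ.+-identityʳ _) (ℤₚ.*-identityˡ _)) ⟩
      monoδ (lower w) (lower m)               ≡⟨ same-δ ⟩
      monoδ w m                               ∎
      where
      open ≡-Reasoning
      same-δ : monoδ (lower w) (lower m) ≡ monoδ w m
      same-δ with ≡-dec _≟_ (norm w) (norm m)
      ... | yes e = monoδ-≡ (lower w) (lower m) (lower-norm w m e)
      ... | no ne = monoδ-≢ (lower w) (lower m)
                      (λ e → ne (lower-injective w m (expo-i≡0 w nzw) (expo-i≡0 m nzm) e))

    HeightAbove : ℕ → Set
    HeightAbove r = ∀ m → expo m (suc i) ≢ 0 → N + N < height m + r → coeff D m ≡ + 0

    heightAbove-0 : HeightAbove 0
    heightAbove-0 m es lt with coeff D m ℤ.≟ + 0
    ... | yes z = z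
    ... | no nz = ⊥-elim (<-irrefl refl (<-≤-trans lt (begin
      height m + 0   ≡⟨ +-identityʳ (height m) ⟩
      height m       ≤⟨ weight-mono-≤ m β suc β≤suc ⟩
      weight m suc   ≤⟨ light m nz ⟩
      N + N          ∎)))
      where open ≤-Reasoning

    heightAbove-suc : ∀ r → HeightAbove r → HeightAbove (suc r)
    heightAbove-suc r above m es lt with coeff D m ℤ.≟ + 0
    ... | yes z = z
    ... | no nz = begin
      coeff D m                                                ≡⟨ coeff≡linear D m ⟩
      linear (λ u → monoδ u m) D                               ≡⟨ sym shift-at-lower ⟩
      linear (λ u → coeff (evalMono shift u) (lower m)) D      ≡⟨ sym (fixed (lower m)) ⟩
      coeff D (lower m)                                        ≡⟨ noVar-i (lower m) (lower-has-i m nz es) ⟩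
      + 0                                                      ∎
      where
      open ≡-Reasoning
      heavier : ∀ w → expo w (suc i) ≢ 0 → height m < height w → coeff D w ≡ + 0
      heavier w ew lt' = above w ew (<-≤-trans lt (≤-trans (≤-reflexive (+-suc (height m) r)) (+-monoˡ-≤ r lt')))
      shift-at-lower = linear-cong-support _ _ D (RespNorm-evalMono shift (lower m))
        (λ u u' e → monoδ-normˡ u u' m e) (coeff-shift-at-lower m nz es heavier)

    heightAbove : ∀ r → HeightAbove r
    heightAbove zero = heightAbove-0
    heightAbove (suc r) = heightAbove-suc r (heightAbove r)

    noVar-suc-i : NoVar (suc i)
    noVar-suc-i m es = heightAbove (suc (N + N)) m es (m≤n+m (suc (N + N)) (height m))

  noVar-from-n : ∀ r → NoVar (n + r)
  noVar-from-n zero = subst NoVar (sym (+-identityʳ n)) noVar-n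
  noVar-from-n (suc r) = subst NoVar (sym (+-suc n r)) (Step.noVar-suc-i (n + r) (m≤m+n n r) (noVar-from-n r))

  D≈0P : D ≈ 0P
  D≈0P m with coeff D m ℤ.≟ + 0
  ... | yes z = z
  ... | no nz with heavy m nz
  ...   | (j , N≤j , ej) = subst NoVar (m+[n∸m]≡n (≤-trans (n≤1+n n) N≤j)) (noVar-from-n (j ∸ n)) m ej

shift-invariant≈0P : ∀ n D → DegLe D (2 * suc n) → (∀ m → coeff D m ≢ + 0 → HasVarAbove (suc n) m) →
                     D ≈ eval shift D → D ≈ 0P
shift-invariant≈0P n D deg heavy fixed =
  Vanishing.D≈0P n D light heavy (λ m → trans (fixed m) (coeff-eval shift D m))
  where
  light : ∀ m → coeff D m ≢ + 0 → weight m suc ≤ suc n + suc n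
  light m nz = subst₂ _≤_ (wdeg'≡weight 1 m) (cong (_+_ (suc n)) (+-identityʳ (suc n))) (deg m nz)

-- Differences of admissible series

DegLe--P : ∀ p q d → DegLe p d → DegLe q d → DegLe (p -P q) d
DegLe--P p q d degp degq m nz with support--P p q m nz
... | inj₁ nzp = degp m nzp
... | inj₂ nzq = degq m nzq

coeff-var*P : ∀ j a m → expo m j ≡ 0 → coeff (var j *P a) m ≡ + 0
coeff-var*P j a m z = trans (coeff-*P (var j) a m)
  (cong (λ x → + 1 ℤ.* x ℤ.+ + 0) (trans (linear-cong _ _ a no-match) (linear-zero a)))
  where
  no-match : ∀ v → monoδ (monoMul (unitMono j) v) m ≡ + 0
  no-match v = monoδ-≢ (monoMul (unitMono j) v) m λ e → 1+n≢0 (begin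
    suc (expo v j)                       ≡⟨ cong (_+ expo v j) (sym (trans (expo-unitMono j j) (δ-diag j))) ⟩
    expo (unitMono j) j + expo v j       ≡⟨ sym (expo-monoMul (unitMono j) v j) ⟩
    expo (monoMul (unitMono j) v) j      ≡⟨ norm≡⇒expo≗ (monoMul (unitMono j) v) m e j ⟩
    expo m j                             ≡⟨ z ⟩
    0                                    ∎)
    where open ≡-Reasoning

coeff-sumFin : ∀ k (f : Fin k → Poly) m → (∀ i → coeff (f i) m ≡ + 0) → coeff (sumFin k f) m ≡ + 0
coeff-sumFin zero f m h = refl
coeff-sumFin (suc k) f m h = trans (coeff-+P (f Fin.zero) _ m)
  (cong₂ ℤ._+_ (h Fin.zero) (coeff-sumFin k (λ i → f (Fin.suc i)) m (λ i → h (Fin.suc i))))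

InIdeal⇒HasVarAbove : ∀ n p m → InIdeal (suc n) p → coeff p m ≢ + 0 → HasVarAbove (suc n) m
InIdeal⇒HasVarAbove n p m (a , p≈) nz with any? (λ t → ¬? (expo m (suc n + toℕ t) ≟ 0))
... | yes (t , et) = suc n + toℕ t , m≤m+n (suc n) (toℕ t) , et
... | no none = ⊥-elim (nz (trans (p≈ m) (coeff-sumFin (suc n) (λ t → σ (suc (suc n) + toℕ t) *P a t) m λ t →
        coeff-var*P (suc n + toℕ t) (a t) m (decidable-stable (expo m (suc n + toℕ t) ≟ 0) (λ et → none (t , et))))))

difference-shift-invariant : ∀ p p' q q' r → p ≈ q →
  p' -P r *P p ≈ eval shift p' → q' -P r *P q ≈ eval shift q' →
  p' -P q' ≈ eval shift (p' -P q')
difference-shift-invariant p p' q q' r p≈q fun-p fun-q m = begin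
  coeff (p' -P q') m                                                   ≡⟨ coeff--P p' q' m ⟩
  coeff p' m ℤ.- coeff q' m                                            ≡⟨ cancel (coeff p' m) (coeff q' m) (coeff (r *P p) m) ⟩
  (coeff p' m ℤ.- coeff (r *P p) m) ℤ.- (coeff q' m ℤ.- coeff (r *P p) m)
                                                     ≡⟨ cong (λ x → (coeff p' m ℤ.- coeff (r *P p) m) ℤ.- (coeff q' m ℤ.- x)) (*P-congʳ r p q p≈q m) ⟩
  (coeff p' m ℤ.- coeff (r *P p) m) ℤ.- (coeff q' m ℤ.- coeff (r *P q) m)
                                                     ≡⟨ sym (cong₂ ℤ._-_ (coeff--P p' (r *P p) m) (coeff--P q' (r *P q) m)) ⟩
  coeff (p' -P r *P p) m ℤ.- coeff (q' -P r *P q) m                    ≡⟨ cong₂ ℤ._-_ (fun-p m) (fun-q m) ⟩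
  coeff (eval shift p') m ℤ.- coeff (eval shift q') m                  ≡⟨ sym (coeff-eval--P shift p' q' m) ⟩
  coeff (eval shift (p' -P q')) m                                      ∎
  where
  open ≡-Reasoning
  cancel : ∀ a b x → a ℤ.- b ≡ (a ℤ.- x) ℤ.- (b ℤ.- x)
  cancel = solve-∀
  coeff-eval--P : ∀ s p q m → coeff (eval s (p -P q)) m ≡ coeff (eval s p) m ℤ.- coeff (eval s q) m
  coeff-eval--P s p q m = trans (coeff-eval s (p -P q) m)
    (trans (linear--P _ p q) (sym (cong₂ ℤ._-_ (coeff-eval s p m) (coeff-eval s q m))))

proposition2p5 : (U V : Series) → Admissible U → Admissible V → (n : ℕ) → U n ≈ V n
proposition2p5 U V (U₀ , _ , _ , _) (V₀ , _ , _ , _) zero m = trans (U₀ m) (sym (V₀ m))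
proposition2p5 U V aU@(_ , degU , idealU , funU) aV@(_ , degV , idealV , funV) (suc n) =
  -P≈0P⇒≈ (U (suc n)) (V (suc n)) (shift-invariant≈0P n D degree heavy fixed)
  where
  D : Poly
  D = U (suc n) -P V (suc n)
  degree : DegLe D (2 * suc n)
  degree = DegLe--P (U (suc n)) (V (suc n)) (2 * suc n) (degU n) (degV n)
  heavy : ∀ m → coeff D m ≢ + 0 → HasVarAbove (suc n) m
  heavy m nz with support--P (U (suc n)) (V (suc n)) m nz
  ... | inj₁ nzU = InIdeal⇒HasVarAbove n (U (suc n)) m (idealU n) nzU
  ... | inj₂ nzV = InIdeal⇒HasVarAbove n (V (suc n)) m (idealV n) nzV
  fixed : D ≈ eval shift D
  fixed = difference-shift-invariant (U n) (U (suc n)) (V n) (V (suc n)) (σ 1)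
            (proposition2p5 U V aU aV n) (proj₂ funU n) (proj₂ funV n)
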